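{- For any positive integers $n$ and $L\le\sqrt{n/2}$ with $L$ divisible by $4$, there exists a bipartite graph $G=(C\cup S,E)$ with $|C|=n$ and $\mathrm{opt}(G)=L$, together with an ordering in which the clients of $C$ are inserted, such that any algorithm for the exact online assignment problem requires a total of $\Omega(nL)$ changes to its assignment. This holds even if the algorithm knows the entire graph $G$ and the insertion order in advance.
   Context: An assignment $\mathcal A: C\to S$ maps each client $c$ to a neighboring server. The load $\ell_{\mathcal A}(s)$ is the number of clients assigned to $s$, $\ell(\mathcal A)=\max_{s\in S}\ell_{\mathcal A}(s)$, and $\mathrm{opt}(G)$ is the minimum of $\ell(\mathcal A)$ over all assignments. In the exact online assignment problem, clients are inserted one by one with all their incident edges; letting $G_t$ be the graph after $t$ clients have arrived and $\mathcal A_t$ the algorithm's assignment at that time, the algorithm must ensure $\ell(\mathcal A_t)=\mathrm{opt}(G_t)$ for all $t$. A change is the reassignment of one client (changing which server it is assigned to). -}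

module Defs where

open import Data.Nat using (ℕ; suc; _≤_; _<_; _⊔_; _<?_)
open import Data.Fin using (Fin; toℕ; _≟_)
open import Data.Bool using (Bool; true)
open import Data.List using (List; length; filter; map; foldr; upTo; allFin)
open import Data.Nat.ListAction using (sum)
open import Data.Product using (Σ; _×_; ∃)
open import Relation.Nullary.Decidable using (_×-dec_; ¬?)
open import Relation.Binary.PropositionalEquality using (_≡_)

-- A bipartite graph with clients C = Fin n and servers S = Fin m,
-- given by its adjacency relation: adj c s ≡ true iff {c,s} ∈ E.
-- Clients are inserted in the order 0, 1, ..., n-1 (clients are labelled
-- by their insertion time), so G_t is the subgraph induced by the clients
-- c with toℕ c < t (together with all servers).
Graph : ℕ → ℕ → Set
Graph n m = Fin n → Fin m → Bool

-- An assignment of G_t is represented as a total map Fin n → Fin m whose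
-- values are only relevant on the clients c with toℕ c < t.
Assignment : ℕ → ℕ → Set
Assignment n m = Fin n → Fin m

ValidAt : ∀ {n m} → Graph n m → ℕ → Assignment n m → Set
ValidAt {n} adj t B = ∀ (c : Fin n) → toℕ c < t → adj c (B c) ≡ true

loadAt : ∀ {n m} → ℕ → Assignment n m → Fin m → ℕ
loadAt {n} t B s = length (filter (λ c → (toℕ c <? t) ×-dec (B c ≟ s)) (allFin n))

-- ℓ(B) = max over servers of the load (0 if there are no servers).
maxLoadAt : ∀ {n m} → ℕ → Assignment n m → ℕ
maxLoadAt {n} {m} t B = foldr _⊔_ 0 (map (loadAt t B) (allFin m))

OptimalAt : ∀ {n m} → Graph n m → ℕ → Assignment n m → Set
OptimalAt adj t B =
  ValidAt adj t B × (∀ B' → ValidAt adj t B' → maxLoadAt t B ≤ maxLoadAt t B')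

OptIs : ∀ {n m} → Graph n m → ℕ → Set
OptIs {n} adj L = ∃ λ B → OptimalAt adj n B × maxLoadAt n B ≡ L

-- An (offline-knowing) algorithm's run: A t is its assignment 𝒜_t after
-- t clients have arrived (t = 0, ..., n).
Run : ℕ → ℕ → Set
Run n m = ℕ → Assignment n m

Exact : ∀ {n m} → Graph n m → Run n m → Set
Exact {n} adj A = ∀ t → t ≤ n → OptimalAt adj t (A t)

-- Changes from 𝒜_t to 𝒜_{t+1}: clients already present at time t whose
-- server differs (the initial assignment of the newly inserted client is not a change).
changesAt : ∀ {n m} → Run n m → ℕ → ℕ
changesAt {n} A t =
  length (filter (λ c → (toℕ c <? t) ×-dec ¬? (A t c ≟ A (suc t) c)) (allFin n))

totalChanges : ∀ {n m} → Run n m → ℕ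
totalChanges {n} A = sum (map (changesAt A) (upTo n))

module Submission where

-- Servers 0, …, C − 1 form a line; every client not mentioned
-- below gets a private server of its own (load 1, never relevant).  Between
-- line servers k − 1 and k there are nFlex k = min(M, k, C − k) flexible
-- clients, adjacent to both; all other clients are fixed to one line server.
-- Clients arrive in rounds of C: first the flexible ones, then J warm-up
-- rounds, then P phases of two rounds each.  The fixed clients are chosen so
-- that after phase p, orienting every flexible client "right" (to k) for even
-- p and "left" (to k − 1) for odd p gives every line server load exactly J + p.
--
-- The argument.  (1) That orientation has maximum load J + p, so an exact
-- algorithm has maximum load at most J + p at the end of phase p; at the end
-- the clients whose right server is 0 have no other neighbour, so opt = J + P.
-- (2) Any assignment of maximum load J + p must use exactly that orientation:
-- by induction along the line from its start (or end), a flexible client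
-- pointing the wrong way would join an already full server.  (3) Hence an
-- exact algorithm moves all Φ = Σ nFlex k flexible clients in every phase,
-- at least P·Φ changes in total, and Φ ≥ C·M − 2M².  (4) Choosing M = L/4,
-- J = P = L/2 and C = ⌊4n/7L⌋ yields opt(G) = L and n·L ≤ 56·(total changes).

open import Defs
open import Data.Nat
open import Data.Nat.Properties
open import Data.Nat.DivMod
open import Data.Nat.Divisibility using (_∣_; divides; divides-refl)
open import Data.Bool using (Bool; true; false; not; _∧_; _∨_; if_then_else_; T)
open import Data.Bool.Properties using (not-involutive; ∨-zeroʳ)
open import Data.Fin using (Fin; toℕ; fromℕ<) renaming (_≟_ to _≟ᶠ_)
open import Data.Fin.Properties using (toℕ-fromℕ<; toℕ<n; toℕ-injective)
open import Data.List using (List; []; _∷_; length; filter; map; foldr; upTo; allFin; tabulate; applyUpTo)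
open import Data.List.Properties using (map-tabulate; map-applyUpTo; map-cong)
open import Data.List.Membership.Propositional using (_∈_)
open import Data.List.Membership.Propositional.Properties using (∈-allFin)
open import Data.List.Relation.Unary.Any using (here; there)
open import Data.Nat.ListAction using (sum)
open import Data.Product using (Σ; ∃; _×_; _,_; proj₁; proj₂)
open import Data.Sum using (_⊎_; inj₁; inj₂)
open import Data.Empty using (⊥-elim)
open import Function using (_∘_)
open import Relation.Nullary using (Dec; yes; no; does)
open import Relation.Nullary.Decidable using (_×-dec_; ¬?)
open import Relation.Binary.PropositionalEquality
open import Data.Nat.Tactic.RingSolver using (solve-∀)
open import Algebra.Properties.CommutativeSemigroup +-commutativeSemigroup using () renaming (interchange to +-interchange)

𝟙 : Bool → ℕ
𝟙 true  = 1
𝟙 false = 0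

𝟙-∧ : ∀ a b → 𝟙 (a ∧ b) ≡ 𝟙 a * 𝟙 b
𝟙-∧ true  b = sym (+-identityʳ _)
𝟙-∧ false b = refl

≤𝟙 : ∀ x b → x ≤ 1 → (1 ≤ x → b ≡ true) → x ≤ 𝟙 b
≤𝟙 zero          b _               _ = z≤n
≤𝟙 (suc zero)    b _               h rewrite h ≤-refl = ≤-refl
≤𝟙 (suc (suc x)) b (s≤s ())        _

-- Boolean comparisons as propositions, in the form ( … ≡ true/false ) used
-- with 'with … in'.  Counting is done with indicators of _<ᵇ_ and _≡ᵇ_
-- because these compute by evaluation.
<ᵇ⇒<′ : ∀ {a b} → (a <ᵇ b) ≡ true → a < b
<ᵇ⇒<′ {a} {b} e = <ᵇ⇒< a b (subst T (sym e) _)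

<⇒<ᵇ′ : ∀ {a b} → a < b → (a <ᵇ b) ≡ true
<⇒<ᵇ′ {a} {b} a<b with a <ᵇ b | <⇒<ᵇ a<b
... | true | _ = refl

≥⇒≮ᵇ : ∀ {a b} → b ≤ a → (a <ᵇ b) ≡ false
≥⇒≮ᵇ {a} {b} b≤a with a <ᵇ b in e
... | true  = ⊥-elim (<⇒≱ (<ᵇ⇒<′ e) b≤a)
... | false = refl

≡ᵇ⇒≡′ : ∀ {a b} → (a ≡ᵇ b) ≡ true → a ≡ b
≡ᵇ⇒≡′ {a} {b} e = ≡ᵇ⇒≡ a b (subst T (sym e) _)

≡ᵇ-refl : ∀ a → (a ≡ᵇ a) ≡ true
≡ᵇ-refl zero    = refl
≡ᵇ-refl (suc a) = ≡ᵇ-refl a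

≢⇒≢ᵇ : ∀ {a b} → a ≢ b → (a ≡ᵇ b) ≡ false
≢⇒≢ᵇ {a} {b} a≢b with a ≡ᵇ b in e
... | true  = ⊥-elim (a≢b (≡ᵇ⇒≡′ e))
... | false = refl

∑ : ℕ → (ℕ → ℕ) → ℕ
∑ zero    f = 0
∑ (suc n) f = ∑ n f + f n

infix 6.5 ∑
syntax ∑ n (λ i → e) = ∑[ i < n ] e

∑-front : ∀ n (f : ℕ → ℕ) → ∑ (suc n) f ≡ f 0 + ∑ n (f ∘ suc)
∑-front zero    f = +-comm 0 (f 0)
∑-front (suc n) f rewrite ∑-front n f = +-assoc (f 0) (∑ n (f ∘ suc)) (f (suc n))

∑-split : ∀ a b (f : ℕ → ℕ) → ∑ (a + b) f ≡ ∑ a f + ∑[ u < b ] f (a + u)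
∑-split a zero    f rewrite +-identityʳ a = sym (+-identityʳ (∑ a f))
∑-split a (suc b) f rewrite +-suc a b | ∑-split a b f = +-assoc (∑ a f) _ (f (a + b))

∑-cong : ∀ n {f g : ℕ → ℕ} → (∀ i → i < n → f i ≡ g i) → ∑ n f ≡ ∑ n g
∑-cong zero    h = refl
∑-cong (suc n) h = cong₂ _+_ (∑-cong n (λ i i<n → h i (m<n⇒m<1+n i<n))) (h n ≤-refl)

∑-mono : ∀ n {f g : ℕ → ℕ} → (∀ i → i < n → f i ≤ g i) → ∑ n f ≤ ∑ n g
∑-mono zero    h = z≤n
∑-mono (suc n) h = +-mono-≤ (∑-mono n (λ i i<n → h i (m<n⇒m<1+n i<n))) (h n ≤-refl)

∑-zero : ∀ n {f : ℕ → ℕ} → (∀ i → i < n → f i ≡ 0) → ∑ n f ≡ 0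
∑-zero zero    h = refl
∑-zero (suc n) h = cong₂ _+_ (∑-zero n (λ i i<n → h i (m<n⇒m<1+n i<n))) (h n ≤-refl)

∑-const : ∀ n c → ∑[ _ < n ] c ≡ n * c
∑-const zero    c = refl
∑-const (suc n) c rewrite ∑-const n c = +-comm (n * c) c

∑-+ : ∀ n (f g : ℕ → ℕ) → ∑[ i < n ] (f i + g i) ≡ ∑ n f + ∑ n g
∑-+ zero    f g = refl
∑-+ (suc n) f g rewrite ∑-+ n f g = +-interchange (∑ n f) (∑ n g) (f n) (g n)

∑-swap : ∀ A B (f : ℕ → ℕ → ℕ) → ∑[ a < A ] ∑ B (f a) ≡ ∑[ b < B ] ∑[ a < A ] f a b
∑-swap zero    B f = sym (∑-zero B (λ _ _ → refl))
∑-swap (suc A) B f = trans (cong (_+ ∑ B (f A)) (∑-swap A B f))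
                           (sym (∑-+ B (λ b → ∑[ a < A ] f a b) (f A)))

∑-blocks : ∀ R C .{{_ : NonZero C}} (h : ℕ → ℕ → ℕ) →
  ∑[ j < R * C ] h (j / C) (j % C) ≡ ∑[ ρ < R ] ∑ C (h ρ)
∑-blocks zero    C h = refl
∑-blocks (suc R) C h = begin
    ∑[ j < C + R * C ] h (j / C) (j % C)        ≡⟨ cong (λ x → ∑[ j < x ] h (j / C) (j % C)) (+-comm C (R * C)) ⟩
    ∑[ j < R * C + C ] h (j / C) (j % C)        ≡⟨ ∑-split (R * C) C _ ⟩
    ∑[ j < R * C ] h (j / C) (j % C)
      + ∑[ u < C ] h ((R * C + u) / C) ((R * C + u) % C)
                                                ≡⟨ cong₂ _+_ (∑-blocks R C h) (∑-cong C (λ u u<C → cong₂ h (block u u<C) (offset u u<C))) ⟩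
    ∑[ ρ < R ] ∑ C (h ρ) + ∑ C (h R)            ∎
  where
  open ≡-Reasoning
  block : ∀ u → u < C → (R * C + u) / C ≡ R
  block u u<C = begin
    (R * C + u) / C       ≡⟨ +-distrib-/-∣ˡ u (divides-refl R) ⟩
    R * C / C + u / C     ≡⟨ cong₂ _+_ (m*n/n≡m R C) (m<n⇒m/n≡0 u<C) ⟩
    R + 0                 ≡⟨ +-identityʳ R ⟩
    R                     ∎
  offset : ∀ u → u < C → (R * C + u) % C ≡ u
  offset u u<C = trans (cong (_% C) (+-comm (R * C) u)) (trans ([m+kn]%n≡m%n u R C) (m<n⇒m%n≡m u<C))

∑-prefix : ∀ T n (f : ℕ → ℕ) → T ≤ n → ∑[ i < n ] 𝟙 (i <ᵇ T) * f i ≡ ∑ T f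
∑-prefix T n f T≤n = begin
    ∑[ i < n ] 𝟙 (i <ᵇ T) * f i                         ≡⟨ cong (λ x → ∑[ i < x ] 𝟙 (i <ᵇ T) * f i) (sym (m+[n∸m]≡n T≤n)) ⟩
    ∑[ i < T + (n ∸ T) ] 𝟙 (i <ᵇ T) * f i               ≡⟨ ∑-split T (n ∸ T) _ ⟩
    ∑[ i < T ] 𝟙 (i <ᵇ T) * f i
      + ∑[ u < n ∸ T ] 𝟙 (T + u <ᵇ T) * f (T + u)        ≡⟨ cong₂ _+_ (∑-cong T inside) (∑-zero (n ∸ T) outside) ⟩
    ∑ T f + 0                                          ≡⟨ +-identityʳ _ ⟩
    ∑ T f                                              ∎
  where
  open ≡-Reasoning
  inside : ∀ i → i < T → 𝟙 (i <ᵇ T) * f i ≡ f i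
  inside i i<T rewrite <⇒<ᵇ′ i<T = +-identityʳ (f i)
  outside : ∀ u → u < n ∸ T → 𝟙 (T + u <ᵇ T) * f (T + u) ≡ 0
  outside u _ rewrite ≥⇒≮ᵇ {T + u} {T} (m≤m+n T u) = refl

count-below : ∀ x R → x ≤ R → ∑[ r < R ] 𝟙 (r <ᵇ x) ≡ x
count-below x R x≤R = begin
    ∑[ r < R ] 𝟙 (r <ᵇ x)        ≡⟨ ∑-cong R (λ r _ → sym (*-identityʳ _)) ⟩
    ∑[ r < R ] 𝟙 (r <ᵇ x) * 1    ≡⟨ ∑-prefix x R (λ _ → 1) x≤R ⟩
    ∑[ _ < x ] 1                 ≡⟨ ∑-const x 1 ⟩
    x * 1                        ≡⟨ *-identityʳ x ⟩
    x                            ∎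
  where open ≡-Reasoning

∑-point-outside : ∀ x n (f : ℕ → ℕ) → n ≤ x → ∑[ k < n ] 𝟙 (k ≡ᵇ x) * f k ≡ 0
∑-point-outside x n f n≤x =
  ∑-zero n (λ k k<n → cong (λ b → 𝟙 b * f k) (≢⇒≢ᵇ (<⇒≢ (<-≤-trans k<n n≤x))))

∑-point : ∀ x n (f : ℕ → ℕ) → x < n → ∑[ k < n ] 𝟙 (k ≡ᵇ x) * f k ≡ f x
∑-point x (suc n) f x<1+n with x <? n
... | yes x<n rewrite ∑-point x n f x<n | ≢⇒≢ᵇ (>⇒≢ x<n) = +-identityʳ (f x)
... | no x≮n with ≤-antisym (s≤s⁻¹ x<1+n) (≮⇒≥ x≮n)
...   | refl rewrite ∑-point-outside x x f ≤-refl | ≡ᵇ-refl x = +-identityʳ (f x)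

count-point : ∀ y T → y < T → ∑[ i < T ] 𝟙 (i ≡ᵇ y) ≡ 1
count-point y T y<T = trans (∑-cong T (λ i _ → sym (*-identityʳ _))) (∑-point y T (λ _ → 1) y<T)

count-point-≤1 : ∀ y T → ∑[ i < T ] 𝟙 (i ≡ᵇ y) ≤ 1
count-point-≤1 y T with y <? T
... | yes y<T = ≤-reflexive (count-point y T y<T)
... | no y≮T  = ≤-trans (≤-reflexive (trans (∑-cong T (λ i _ → sym (*-identityʳ _)))
                                           (∑-point-outside y T (λ _ → 1) (≮⇒≥ y≮T)))) z≤n

sum-map-mono : ∀ {A : Set} (f g : A → ℕ) (xs : List A) → (∀ x → f x ≤ g x) →
  sum (map f xs) ≤ sum (map g xs)
sum-map-mono f g []       h = z≤n
sum-map-mono f g (x ∷ xs) h = +-mono-≤ (h x) (sum-map-mono f g xs h)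

sum-map-+ : ∀ {A : Set} (f g : A → ℕ) (xs : List A) →
  sum (map (λ x → f x + g x) xs) ≡ sum (map f xs) + sum (map g xs)
sum-map-+ f g []       = refl
sum-map-+ f g (x ∷ xs) rewrite sum-map-+ f g xs = +-interchange (f x) (g x) (sum (map f xs)) (sum (map g xs))

sum-map-zero : ∀ {A : Set} (xs : List A) → sum (map (λ _ → 0) xs) ≡ 0
sum-map-zero []       = refl
sum-map-zero (x ∷ xs) = sum-map-zero xs

length-filter : ∀ {A : Set} {P : A → Set} (P? : (x : A) → Dec (P x)) (xs : List A) →
  length (filter P? xs) ≡ sum (map (λ x → 𝟙 (does (P? x))) xs)
length-filter P? []       = refl
length-filter P? (x ∷ xs) with does (P? x)
... | true  = cong suc (length-filter P? xs)
... | false = length-filter P? xs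

sum-allFin : ∀ n (g : ℕ → ℕ) → sum (map (λ c → g (toℕ c)) (allFin n)) ≡ ∑ n g
sum-allFin n g = trans (cong sum (map-tabulate {n = n} (λ x → x) (λ c → g (toℕ c)))) (sum-tabulate n g)
  where
  sum-tabulate : ∀ n (g : ℕ → ℕ) → sum (tabulate {n = n} (λ c → g (toℕ c))) ≡ ∑ n g
  sum-tabulate zero    g = refl
  sum-tabulate (suc n) g = trans (cong (g 0 +_) (sum-tabulate n (g ∘ suc))) (sym (∑-front n g))

sum-upTo : ∀ n (f : ℕ → ℕ) → sum (map f (upTo n)) ≡ ∑ n f
sum-upTo n f = trans (cong sum (map-applyUpTo (λ x → x) f n)) (sum-applyUpTo n f)
  where
  sum-applyUpTo : ∀ n (f : ℕ → ℕ) → sum (applyUpTo f n) ≡ ∑ n f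
  sum-applyUpTo zero    f = refl
  sum-applyUpTo (suc n) f = trans (cong (f 0 +_) (sum-applyUpTo n (f ∘ suc))) (sym (∑-front n f))

max-upper : ∀ {A : Set} (f : A → ℕ) (xs : List A) x → x ∈ xs → f x ≤ foldr _⊔_ 0 (map f xs)
max-upper f (y ∷ xs) x (here refl) = m≤m⊔n (f x) _
max-upper f (y ∷ xs) x (there x∈) = ≤-trans (max-upper f xs x x∈) (m≤n⊔m (f y) _)

max-least : ∀ {A : Set} (f : A → ℕ) (xs : List A) j → (∀ x → f x ≤ j) → foldr _⊔_ 0 (map f xs) ≤ j
max-least f []       j h = z≤n
max-least f (y ∷ xs) j h = ⊔-lub (h y) (max-least f xs j h)

module _ {n m : ℕ} where

  loadAt-sum : ∀ t (B : Assignment n m) s →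
    loadAt t B s ≡ sum (map (λ c → 𝟙 ((toℕ c <ᵇ t) ∧ does (B c ≟ᶠ s))) (allFin n))
  loadAt-sum t B s = length-filter (λ c → (toℕ c <? t) ×-dec (B c ≟ᶠ s)) (allFin n)

  load≤maxLoad : ∀ t (B : Assignment n m) s → loadAt t B s ≤ maxLoadAt t B
  load≤maxLoad t B s = max-upper (loadAt t B) (allFin m) s (∈-allFin s)

  maxLoad≤ : ∀ t (B : Assignment n m) j → (∀ s → loadAt t B s ≤ j) → maxLoadAt t B ≤ j
  maxLoad≤ t B j = max-least (loadAt t B) (allFin m) j

  𝟙-assigned : ∀ (B : Assignment n m) c s → toℕ (B c) ≡ toℕ s → 1 ≤ 𝟙 (does (B c ≟ᶠ s))
  𝟙-assigned B c s e with B c ≟ᶠ s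
  ... | yes _ = ≤-refl
  ... | no ne = ⊥-elim (ne (toℕ-injective e))

  load-≥ : ∀ (B : Assignment n m) T (g : ℕ → ℕ) s → T ≤ n →
    (∀ c → toℕ c < T → g (toℕ c) ≤ 𝟙 (does (B c ≟ᶠ s))) → ∑ T g ≤ loadAt T B s
  load-≥ B T g s T≤n h = begin
      ∑ T g                                                         ≡⟨ ∑-prefix T n g T≤n ⟨
      ∑[ i < n ] 𝟙 (i <ᵇ T) * g i                                   ≡⟨ sum-allFin n (λ i → 𝟙 (i <ᵇ T) * g i) ⟨
      sum (map (λ c → 𝟙 (toℕ c <ᵇ T) * g (toℕ c)) (allFin n))       ≤⟨ sum-map-mono _ _ (allFin n) termwise ⟩
      sum (map (λ c → 𝟙 ((toℕ c <ᵇ T) ∧ does (B c ≟ᶠ s))) (allFin n)) ≡⟨ loadAt-sum T B s ⟨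
      loadAt T B s                                                  ∎
    where
    open ≤-Reasoning
    termwise : ∀ c → 𝟙 (toℕ c <ᵇ T) * g (toℕ c) ≤ 𝟙 ((toℕ c <ᵇ T) ∧ does (B c ≟ᶠ s))
    termwise c with toℕ c <ᵇ T in e
    ... | true  = ≤-trans (≤-reflexive (+-identityʳ _)) (h c (<ᵇ⇒<′ e))
    ... | false = z≤n

  load-follows : ∀ (B : Assignment n m) T (f : ℕ → ℕ) s → T ≤ n →
    (∀ c → toℕ (B c) ≡ f (toℕ c)) → loadAt T B s ≡ ∑[ i < T ] 𝟙 (f i ≡ᵇ toℕ s)
  load-follows B T f s T≤n follows = begin
      loadAt T B s                                                   ≡⟨ loadAt-sum T B s ⟩
      sum (map (λ c → 𝟙 ((toℕ c <ᵇ T) ∧ does (B c ≟ᶠ s))) (allFin n))  ≡⟨ cong sum (map-cong termwise (allFin n)) ⟩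
      sum (map (λ c → 𝟙 (toℕ c <ᵇ T) * 𝟙 (f (toℕ c) ≡ᵇ toℕ s)) (allFin n)) ≡⟨ sum-allFin n (λ i → 𝟙 (i <ᵇ T) * 𝟙 (f i ≡ᵇ toℕ s)) ⟩
      ∑[ i < n ] 𝟙 (i <ᵇ T) * 𝟙 (f i ≡ᵇ toℕ s)                        ≡⟨ ∑-prefix T n _ T≤n ⟩
      ∑[ i < T ] 𝟙 (f i ≡ᵇ toℕ s)                                    ∎
    where
    open ≡-Reasoning
    same-server : ∀ c → does (B c ≟ᶠ s) ≡ (f (toℕ c) ≡ᵇ toℕ s)
    same-server c with B c ≟ᶠ s
    ... | yes refl = sym (subst (λ x → (x ≡ᵇ toℕ (B c)) ≡ true) (follows c) (≡ᵇ-refl (toℕ (B c))))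
    ... | no  ne   = sym (≢⇒≢ᵇ (λ e → ne (toℕ-injective (trans (follows c) e))))
    termwise : ∀ c → 𝟙 ((toℕ c <ᵇ T) ∧ does (B c ≟ᶠ s)) ≡ 𝟙 (toℕ c <ᵇ T) * 𝟙 (f (toℕ c) ≡ᵇ toℕ s)
    termwise c = trans (𝟙-∧ (toℕ c <ᵇ T) (does (B c ≟ᶠ s))) (cong (λ b → 𝟙 (toℕ c <ᵇ T) * 𝟙 b) (same-server c))

  moved : Run n m → ℕ → ℕ → ℕ
  moved A t₁ t₂ = sum (map (λ c → 𝟙 ((toℕ c <ᵇ t₁) ∧ not (does (A t₁ c ≟ᶠ A t₂ c)))) (allFin n))

  changesAt-sum : ∀ (A : Run n m) t →
    changesAt A t ≡ sum (map (λ c → 𝟙 ((toℕ c <ᵇ t) ∧ not (does (A t c ≟ᶠ A (suc t) c)))) (allFin n))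
  changesAt-sum A t = length-filter (λ c → (toℕ c <? t) ×-dec ¬? (A t c ≟ᶠ A (suc t) c)) (allFin n)

  moved≤changes : ∀ (A : Run n m) t d → moved A t (t + d) ≤ ∑[ u < d ] changesAt A (t + u)
  moved≤changes A t zero rewrite +-identityʳ t =
    ≤-trans (sum-map-mono _ (λ _ → 0) (allFin n) unmoved) (≤-reflexive (sum-map-zero (allFin n)))
    where
    unmoved : ∀ c → 𝟙 ((toℕ c <ᵇ t) ∧ not (does (A t c ≟ᶠ A t c))) ≤ 0
    unmoved c with A t c ≟ᶠ A t c
    ... | yes _ rewrite 𝟙-∧ (toℕ c <ᵇ t) false = ≤-reflexive (*-zeroʳ (𝟙 (toℕ c <ᵇ t)))
    ... | no ne = ⊥-elim (ne refl)
  moved≤changes A t (suc d) rewrite +-suc t d =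
    ≤-trans (sum-map-mono _ _ (allFin n) last-step)
     (≤-trans (≤-reflexive (sum-map-+ before step (allFin n)))
       (+-mono-≤ (moved≤changes A t d) (≤-reflexive (sym (changesAt-sum A (t + d))))))
    where
    t′ = t + d
    before step : Fin n → ℕ
    before c = 𝟙 ((toℕ c <ᵇ t) ∧ not (does (A t c ≟ᶠ A t′ c)))
    step   c = 𝟙 ((toℕ c <ᵇ t′) ∧ not (does (A t′ c ≟ᶠ A (suc t′) c)))
    last-step : ∀ c → 𝟙 ((toℕ c <ᵇ t) ∧ not (does (A t c ≟ᶠ A (suc t′) c))) ≤ before c + step c
    last-step c with toℕ c <ᵇ t in e
    ... | false = z≤n
    ... | true rewrite <⇒<ᵇ′ {toℕ c} {t′} (≤-trans (<ᵇ⇒<′ e) (m≤m+n t d)) with A t c ≟ᶠ A (suc t′) c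
    ...   | yes _ = z≤n
    ...   | no differ with A t c ≟ᶠ A t′ c | A t′ c ≟ᶠ A (suc t′) c
    ...     | no _     | _        = s≤s z≤n
    ...     | yes _    | no _     = s≤s z≤n
    ...     | yes e₁   | yes e₂   = ⊥-elim (differ (trans e₁ e₂))

  totalChanges-∑ : ∀ (A : Run n m) → totalChanges A ≡ ∑ n (changesAt A)
  totalChanges-∑ A = sum-upTo n (changesAt A)

𝟙-count≤2 : ∀ x → x ≤ 2 → 𝟙 (0 <ᵇ x) + 𝟙 (1 <ᵇ x) ≡ x
𝟙-count≤2 zero                _ = refl
𝟙-count≤2 (suc zero)          _ = refl
𝟙-count≤2 (suc (suc zero))    _ = refl
𝟙-count≤2 (suc (suc (suc x))) (s≤s (s≤s ()))

-- Phases are indexed by p and occupy twice p rounds.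
twice : ℕ → ℕ
twice zero    = 0
twice (suc p) = suc (suc (twice p))

twice-≡ : ∀ p → twice p ≡ p + p
twice-≡ zero    = refl
twice-≡ (suc p) = cong suc (trans (cong suc (twice-≡ p)) (sym (+-suc p p)))

twice-mono : ∀ {p q} → p ≤ q → twice p ≤ twice q
twice-mono {zero}          _         = z≤n
twice-mono {suc p} {suc q} (s≤s p≤q) = s≤s (s≤s (twice-mono p≤q))

flips : ℕ → Bool → Bool
flips zero    b = b
flips (suc p) b = flips p (not b)

flips-not : ∀ p b → flips p (not b) ≡ not (flips p b)
flips-not zero    b = refl
flips-not (suc p) b = flips-not p (not b)

flips-twice : ∀ p b → flips (twice p) b ≡ b
flips-twice zero    b = refl
flips-twice (suc p) b = trans (flips-twice p (not (not b))) (not-involutive b)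

∸-suc-≤ : ∀ c k → c ∸ k ≤ suc (c ∸ suc k)
∸-suc-≤ zero    k       rewrite 0∸n≡0 k = z≤n
∸-suc-≤ (suc c) zero    = ≤-refl
∸-suc-≤ (suc c) (suc k) = ∸-suc-≤ c k

suc-∸-≤2 : ∀ x y → x ≤ suc y → suc x ∸ y ≤ 2
suc-∸-≤2 x y x≤1+y = ≤-trans (∸-monoˡ-≤ y (s≤s x≤1+y)) (≤-reflexive (m+n∸n≡m 2 y))

≤⊓+∸ : ∀ a z → a ≤ a ⊓ z + (a ∸ z)
≤⊓+∸ a z with ≤-total a z
... | inj₁ a≤z rewrite m≤n⇒m⊓n≡m a≤z = m≤m+n a _
... | inj₂ z≤a rewrite m≥n⇒m⊓n≡n z≤a = ≤-reflexive (sym (m+[n∸m]≡n z≤a))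

∸⊓≤ : ∀ a x y → a ∸ (x ⊓ y) ≤ (a ∸ x) + (a ∸ y)
∸⊓≤ a x y with ≤-total x y
... | inj₁ x≤y rewrite m≤n⇒m⊓n≡m x≤y = m≤m+n _ _
... | inj₂ y≤x rewrite m≥n⇒m⊓n≡n y≤x = m≤n+m _ _

∑-∸-≤ : ∀ a c → ∑[ k < c ] (a ∸ k) ≤ a * a
∑-∸-≤ zero     c       = ≤-reflexive (∑-zero c (λ k _ → 0∸n≡0 k))
∑-∸-≤ (suc a) zero    = z≤n
∑-∸-≤ (suc a) (suc c) = ≤-trans (≤-reflexive (∑-front c (λ k → suc a ∸ k)))
                                (+-monoʳ-≤ (suc a) (≤-trans (∑-∸-≤ a c) (*-monoʳ-≤ a (n≤1+n a))))

∑-∸-reverse : ∀ a c → ∑[ k < c ] (a ∸ (c ∸ k)) ≤ ∑[ k < c ] (a ∸ k)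
∑-∸-reverse a zero    = z≤n
∑-∸-reverse a (suc c) = begin
    ∑[ k < suc c ] (a ∸ (suc c ∸ k))              ≡⟨ ∑-front c (λ k → a ∸ (suc c ∸ k)) ⟩
    (a ∸ suc c) + ∑[ k < c ] (a ∸ (c ∸ k))        ≡⟨ +-comm (a ∸ suc c) _ ⟩
    ∑[ k < c ] (a ∸ (c ∸ k)) + (a ∸ suc c)         ≤⟨ +-mono-≤ (∑-∸-reverse a c) (∸-monoʳ-≤ a (n≤1+n c)) ⟩
    ∑[ k < c ] (a ∸ k) + (a ∸ c)                  ∎
  where open ≤-Reasoning

-- The clients of the instance and their servers, for a line of C = suc C′
-- servers, at most M flexible clients per pair of neighbouring servers,
-- warm-up height J ≥ M and P phases.
module Line (C′ M J P : ℕ) (M≤J : M ≤ J) where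

  C : ℕ
  C = suc C′

  nFlex : ℕ → ℕ
  nFlex k = M ⊓ (k ⊓ (C ∸ k))

  nFlex≤M : ∀ k → nFlex k ≤ M
  nFlex≤M k = m⊓n≤m M _

  nFlex-0 : nFlex 0 ≡ 0
  nFlex-0 = ⊓-zeroʳ M

  nFlex-C : nFlex C ≡ 0
  nFlex-C rewrite n∸n≡0 C | ⊓-zeroʳ C = ⊓-zeroʳ M

  nFlex-suc≤ : ∀ k → nFlex (suc k) ≤ suc (nFlex k)
  nFlex-suc≤ k = ⊓-mono-≤ (n≤1+n M) (⊓-mono-≤ (≤-refl {suc k}) (≤-trans (∸-monoʳ-≤ C (n≤1+n k)) (n≤1+n (C ∸ k))))

  nFlex≤suc : ∀ k → nFlex k ≤ suc (nFlex (suc k))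
  nFlex≤suc k = ⊓-mono-≤ (n≤1+n M) (⊓-mono-≤ (≤-trans (n≤1+n k) (n≤1+n (suc k))) (∸-suc-≤ C k))

  -- Orientation true sends every flexible client of pair (k − 1, k) to k,
  -- orientation false to k − 1.  flexOn b k is the resulting number of
  -- flexible clients on server k.
  flexOn : Bool → ℕ → ℕ
  flexOn true  k = nFlex k
  flexOn false k = nFlex (suc k)

  flexOn≤M : ∀ b k → flexOn b k ≤ M
  flexOn≤M true  k = nFlex≤M k
  flexOn≤M false k = nFlex≤M (suc k)

  -- Fixed clients that server k receives in a phase turning orientation b
  -- into not b: enough to raise its load by exactly one.
  added : Bool → ℕ → ℕ
  added true  k = suc (nFlex k) ∸ nFlex (suc k)
  added false k = suc (nFlex (suc k)) ∸ nFlex k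

  added-balance : ∀ b k → added b k + flexOn (not b) k ≡ suc (flexOn b k)
  added-balance true  k = m∸n+n≡m (nFlex-suc≤ k)
  added-balance false k = m∸n+n≡m (nFlex≤suc k)

  added≤2 : ∀ b k → added b k ≤ 2
  added≤2 true  k = suc-∸-≤2 (nFlex k) (nFlex (suc k)) (nFlex≤suc k)
  added≤2 false k = suc-∸-≤2 (nFlex (suc k)) (nFlex k) (nFlex-suc≤ k)

  -- Does round q of the phase section (P′ phases, starting in orientation b)
  -- contain a fixed client of server k?  Each phase has two rounds.
  phaseFixed : Bool → ℕ → ℕ → ℕ → Bool
  phaseFixed b zero     q             k = false
  phaseFixed b (suc P′) zero          k = 0 <ᵇ added b k
  phaseFixed b (suc P′) (suc zero)    k = 1 <ᵇ added b k
  phaseFixed b (suc P′) (suc (suc q)) k = phaseFixed (not b) P′ q k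

  phaseFixed-after : ∀ P′ b q k → twice P′ ≤ q → phaseFixed b P′ q k ≡ false
  phaseFixed-after zero     b q             k _                 = refl
  phaseFixed-after (suc P′) b (suc (suc q)) k (s≤s (s≤s 2P′≤q)) = phaseFixed-after P′ (not b) q k 2P′≤q

  phases-load : ∀ p P′ b k → p ≤ P′ →
    ∑[ q < twice p ] 𝟙 (phaseFixed b P′ q k) + flexOn (flips p b) k ≡ flexOn b k + p
  phases-load zero    P′       b k _         = sym (+-identityʳ _)
  phases-load (suc p) (suc P′) b k (s≤s p≤P′) = begin
      ∑ (suc (suc (twice p))) f + X            ≡⟨ cong (_+ X) (trans (∑-front (suc (twice p)) f) (cong (f 0 +_) (∑-front (twice p) (f ∘ suc)))) ⟩
      f 0 + (f 1 + rest) + X                   ≡⟨ cong (_+ X) (sym (+-assoc (f 0) (f 1) rest)) ⟩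
      f 0 + f 1 + rest + X                     ≡⟨ +-assoc (f 0 + f 1) rest X ⟩
      f 0 + f 1 + (rest + X)                   ≡⟨ cong₂ _+_ (𝟙-count≤2 (added b k) (added≤2 b k)) (phases-load p P′ (not b) k p≤P′) ⟩
      added b k + (flexOn (not b) k + p)       ≡⟨ sym (+-assoc (added b k) _ p) ⟩
      added b k + flexOn (not b) k + p         ≡⟨ cong (_+ p) (added-balance b k) ⟩
      suc (flexOn b k) + p                     ≡⟨ sym (+-suc (flexOn b k) p) ⟩
      flexOn b k + suc p                       ∎
    where
    open ≡-Reasoning
    f : ℕ → ℕ
    f q = 𝟙 (phaseFixed b (suc P′) q k)
    rest = ∑[ q < twice p ] 𝟙 (phaseFixed (not b) P′ q k)
    X = flexOn (flips p (not b)) k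

  -- Does round ρ of the fixed section contain a fixed client of server k?
  -- First J warm-up rounds, of which J − nFlex k hold one, then the phases.
  fixedIn : ℕ → ℕ → Bool
  fixedIn ρ k = if ρ <ᵇ J then ρ <ᵇ (J ∸ nFlex k) else phaseFixed true P (ρ ∸ J) k

  fixedIn-phase : ∀ q k → fixedIn (J + q) k ≡ phaseFixed true P q k
  fixedIn-phase q k rewrite ≥⇒≮ᵇ {J + q} {J} (m≤m+n J q) | m+n∸m≡n J q = refl

  fixedIn-after : ∀ ρ k → J + twice P ≤ ρ → fixedIn ρ k ≡ false
  fixedIn-after ρ k J+2P≤ρ rewrite ≥⇒≮ᵇ {ρ} {J} (m+n≤o⇒m≤o J J+2P≤ρ) =
    phaseFixed-after P true (ρ ∸ J) k (m+n≤o⇒m≤o∸n (twice P) (subst (_≤ ρ) (+-comm J (twice P)) J+2P≤ρ))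

  balanced : ∀ p k → p ≤ P → ∑[ ρ < J + twice p ] 𝟙 (fixedIn ρ k) + flexOn (flips p true) k ≡ J + p
  balanced p k p≤P = begin
      ∑[ ρ < J + twice p ] 𝟙 (fixedIn ρ k) + X          ≡⟨ cong (_+ X) (∑-split J (twice p) _) ⟩
      (warm-up + ∑[ q < twice p ] 𝟙 (fixedIn (J + q) k)) + X
                                                        ≡⟨ cong (λ x → (x + ∑[ q < twice p ] 𝟙 (fixedIn (J + q) k)) + X) warm-up-count ⟩
      (J ∸ nFlex k + ∑[ q < twice p ] 𝟙 (fixedIn (J + q) k)) + X
                                                        ≡⟨ cong (λ x → (J ∸ nFlex k + x) + X) (∑-cong (twice p) (λ q _ → cong 𝟙 (fixedIn-phase q k))) ⟩
      (J ∸ nFlex k + phases) + X                        ≡⟨ +-assoc (J ∸ nFlex k) phases X ⟩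
      J ∸ nFlex k + (phases + X)                        ≡⟨ cong (J ∸ nFlex k +_) (phases-load p P true k p≤P) ⟩
      J ∸ nFlex k + (nFlex k + p)                       ≡⟨ sym (+-assoc (J ∸ nFlex k) (nFlex k) p) ⟩
      J ∸ nFlex k + nFlex k + p                         ≡⟨ cong (_+ p) (m∸n+n≡m (≤-trans (nFlex≤M k) M≤J)) ⟩
      J + p                                             ∎
    where
    open ≡-Reasoning
    X = flexOn (flips p true) k
    warm-up = ∑[ ρ < J ] 𝟙 (fixedIn ρ k)
    phases = ∑[ q < twice p ] 𝟙 (phaseFixed true P q k)
    warm-up-count : warm-up ≡ J ∸ nFlex k
    warm-up-count = trans (∑-cong J (λ ρ ρ<J → cong (λ b → 𝟙 (if b then ρ <ᵇ (J ∸ nFlex k) else phaseFixed true P (ρ ∸ J) k)) (<⇒<ᵇ′ ρ<J)))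
                          (count-below (J ∸ nFlex k) J (m∸n≤m J (nFlex k)))

  -- Client layout: the first flexEnd = M·C clients form M rounds of C, and
  -- client r·C + k is a flexible client of pair (k − 1, k) if r < nFlex k;
  -- the following clients form the rounds of the fixed section, client
  -- flexEnd + ρ·C + k being fixed to k if fixedIn ρ k.  Everybody else is
  -- isolated on a private server.
  flexEnd : ℕ
  flexEnd = M * C

  data Role : Set where
    flexibleAt fixedAt : ℕ → Role
    isolated           : Role

  flexRole : ℕ → ℕ → Role
  flexRole r k = if r <ᵇ nFlex k then flexibleAt k else isolated

  fixedRole : ℕ → ℕ → Role
  fixedRole ρ k = if fixedIn ρ k then fixedAt k else isolated

  role′ : Bool → ℕ → Role
  role′ true  i = flexRole (i / C) (i % C)
  role′ false i = fixedRole ((i ∸ flexEnd) / C) ((i ∸ flexEnd) % C)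

  role : ℕ → Role
  role i = role′ (i <ᵇ flexEnd) i

  role-flex : ∀ i → i < flexEnd → role i ≡ flexRole (i / C) (i % C)
  role-flex i i<F = cong (λ b → role′ b i) (<⇒<ᵇ′ i<F)

  role-fixed : ∀ j → role (flexEnd + j) ≡ fixedRole (j / C) (j % C)
  role-fixed j rewrite ≥⇒≮ᵇ {flexEnd + j} {flexEnd} (m≤m+n flexEnd j) | m+n∸m≡n flexEnd j = refl

  -- The server used in orientation b by a client of a given role; servers
  -- 0 … C − 1 form the line and server C + i is private to client i.
  side : Bool → ℕ → ℕ
  side true  k = k
  side false k = pred k

  serverFor : Bool → Role → ℕ → ℕ
  serverFor b (flexibleAt k) i = side b k
  serverFor b (fixedAt k)    i = k
  serverFor b isolated       i = C + i

  serverOf : Bool → ℕ → ℕ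
  serverOf b i = serverFor b (role i) i

  data WellFormed : Role → Set where
    wf-flexible : ∀ k → 1 ≤ k → k < C → WellFormed (flexibleAt k)
    wf-fixed    : ∀ k → k < C → WellFormed (fixedAt k)
    wf-isolated : WellFormed isolated

  role-wf : ∀ i → WellFormed (role i)
  role-wf i = wf (i <ᵇ flexEnd)
    where
    wf : ∀ b → WellFormed (role′ b i)
    wf true with (i / C) <ᵇ nFlex (i % C) in e
    ... | true  = wf-flexible (i % C) (positive (i % C) (<ᵇ⇒<′ e)) (m%n<n i C)
      where
      positive : ∀ k → i / C < nFlex k → 1 ≤ k
      positive zero    r<0 rewrite nFlex-0 = ⊥-elim (n≮0 r<0)
      positive (suc k) _   = s≤s z≤n
    ... | false = wf-isolated
    wf false with fixedIn ((i ∸ flexEnd) / C) ((i ∸ flexEnd) % C)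
    ... | true  = wf-fixed _ (m%n<n (i ∸ flexEnd) C)
    ... | false = wf-isolated

  isolated-off-line : ∀ k i → k < C → 𝟙 (C + i ≡ᵇ k) ≡ 0
  isolated-off-line k i k<C rewrite ≢⇒≢ᵇ {C + i} {k} (λ e → <⇒≱ k<C (subst (C ≤_) e (m≤m+n C i))) = refl

  flexRole-on : ∀ b k r k′ i → k < C →
    𝟙 (serverFor b (flexRole r k′) i ≡ᵇ k) ≡ 𝟙 (r <ᵇ nFlex k′) * 𝟙 (side b k′ ≡ᵇ k)
  flexRole-on b k r k′ i k<C with r <ᵇ nFlex k′
  ... | true  = sym (+-identityʳ _)
  ... | false = isolated-off-line k i k<C

  fixedRole-on : ∀ b k ρ k′ i → k < C →
    𝟙 (serverFor b (fixedRole ρ k′) i ≡ᵇ k) ≡ 𝟙 (k′ ≡ᵇ k) * 𝟙 (fixedIn ρ k′)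
  fixedRole-on b k ρ k′ i k<C with fixedIn ρ k′
  ... | true  = sym (*-identityʳ (𝟙 (k′ ≡ᵇ k)))
  ... | false = trans (isolated-off-line k i k<C) (sym (*-zeroʳ (𝟙 (k′ ≡ᵇ k))))

  flexRound-on : ∀ b r k → k < C → ∑[ k′ < C ] 𝟙 (r <ᵇ nFlex k′) * 𝟙 (side b k′ ≡ᵇ k) ≡ 𝟙 (r <ᵇ flexOn b k)
  flexRound-on true r k k<C =
    trans (∑-cong C (λ k′ _ → *-comm (𝟙 (r <ᵇ nFlex k′)) _)) (∑-point k C (λ k′ → 𝟙 (r <ᵇ nFlex k′)) k<C)
  flexRound-on false r k k<C = trans (∑-cong C (λ k′ _ → left k′)) right-neighbour
    where
    left : ∀ k′ → 𝟙 (r <ᵇ nFlex k′) * 𝟙 (pred k′ ≡ᵇ k) ≡ 𝟙 (k′ ≡ᵇ suc k) * 𝟙 (r <ᵇ nFlex k′)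
    left zero    rewrite nFlex-0 = refl
    left (suc j) = *-comm (𝟙 (r <ᵇ nFlex (suc j))) _
    right-neighbour : ∑[ k′ < C ] 𝟙 (k′ ≡ᵇ suc k) * 𝟙 (r <ᵇ nFlex k′) ≡ 𝟙 (r <ᵇ nFlex (suc k))
    right-neighbour with suc k <? C
    ... | yes 1+k<C = ∑-point (suc k) C (λ k′ → 𝟙 (r <ᵇ nFlex k′)) 1+k<C
    ... | no  1+k≮C with ≤-antisym k<C (≮⇒≥ 1+k≮C)
    ...   | 1+k≡C = trans (∑-point-outside (suc k) C _ (≤-reflexive (sym 1+k≡C)))
                          (cong (λ x → 𝟙 (r <ᵇ x)) (sym (trans (cong nFlex 1+k≡C) nFlex-C)))

  load-flexSection : ∀ b k → k < C → ∑[ i < flexEnd ] 𝟙 (serverOf b i ≡ᵇ k) ≡ flexOn b k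
  load-flexSection b k k<C = begin
      ∑[ i < flexEnd ] 𝟙 (serverOf b i ≡ᵇ k)
        ≡⟨ ∑-cong flexEnd (λ i i<F → trans (cong (λ R → 𝟙 (serverFor b R i ≡ᵇ k)) (role-flex i i<F)) (flexRole-on b k (i / C) (i % C) i k<C)) ⟩
      ∑[ i < M * C ] 𝟙 (i / C <ᵇ nFlex (i % C)) * 𝟙 (side b (i % C) ≡ᵇ k)
        ≡⟨ ∑-blocks M C (λ r k′ → 𝟙 (r <ᵇ nFlex k′) * 𝟙 (side b k′ ≡ᵇ k)) ⟩
      ∑[ r < M ] ∑[ k′ < C ] 𝟙 (r <ᵇ nFlex k′) * 𝟙 (side b k′ ≡ᵇ k)
        ≡⟨ ∑-cong M (λ r _ → flexRound-on b r k k<C) ⟩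
      ∑[ r < M ] 𝟙 (r <ᵇ flexOn b k)
        ≡⟨ count-below (flexOn b k) M (flexOn≤M b k) ⟩
      flexOn b k ∎
    where open ≡-Reasoning

  load-fixedSection : ∀ b k R → k < C →
    ∑[ j < R * C ] 𝟙 (serverOf b (flexEnd + j) ≡ᵇ k) ≡ ∑[ ρ < R ] 𝟙 (fixedIn ρ k)
  load-fixedSection b k R k<C = begin
      ∑[ j < R * C ] 𝟙 (serverOf b (flexEnd + j) ≡ᵇ k)
        ≡⟨ ∑-cong (R * C) (λ j _ → trans (cong (λ R → 𝟙 (serverFor b R (flexEnd + j) ≡ᵇ k)) (role-fixed j))
                                          (fixedRole-on b k (j / C) (j % C) (flexEnd + j) k<C)) ⟩
      ∑[ j < R * C ] 𝟙 (j % C ≡ᵇ k) * 𝟙 (fixedIn (j / C) (j % C))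
        ≡⟨ ∑-blocks R C (λ ρ k′ → 𝟙 (k′ ≡ᵇ k) * 𝟙 (fixedIn ρ k′)) ⟩
      ∑[ ρ < R ] ∑[ k′ < C ] 𝟙 (k′ ≡ᵇ k) * 𝟙 (fixedIn ρ k′)
        ≡⟨ ∑-cong R (λ ρ _ → ∑-point k C (λ k′ → 𝟙 (fixedIn ρ k′)) k<C) ⟩
      ∑[ ρ < R ] 𝟙 (fixedIn ρ k) ∎
    where open ≡-Reasoning

  -- End of phase p (phase 0 ending with the warm-up).
  phaseEnd : ℕ → ℕ
  phaseEnd p = flexEnd + (J + twice p) * C

  load-phaseEnd : ∀ p k → p ≤ P → k < C → ∑[ i < phaseEnd p ] 𝟙 (serverOf (flips p true) i ≡ᵇ k) ≡ J + p
  load-phaseEnd p k p≤P k<C = begin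
      ∑[ i < phaseEnd p ] 𝟙 (serverOf b i ≡ᵇ k)      ≡⟨ ∑-split flexEnd ((J + twice p) * C) _ ⟩
      ∑[ i < flexEnd ] 𝟙 (serverOf b i ≡ᵇ k)
        + ∑[ j < (J + twice p) * C ] 𝟙 (serverOf b (flexEnd + j) ≡ᵇ k)
                                                     ≡⟨ cong₂ _+_ (load-flexSection b k k<C) (load-fixedSection b k (J + twice p) k<C) ⟩
      flexOn b k + ∑[ ρ < J + twice p ] 𝟙 (fixedIn ρ k) ≡⟨ +-comm (flexOn b k) _ ⟩
      ∑[ ρ < J + twice p ] 𝟙 (fixedIn ρ k) + flexOn b k ≡⟨ balanced p k p≤P ⟩
      J + p                                          ∎
    where
    open ≡-Reasoning
    b = flips p true

  role-after : ∀ i → phaseEnd P ≤ i → role i ≡ isolated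
  role-after i P≤i = begin
      role i                                  ≡⟨ cong role (sym (m+[n∸m]≡n F≤i)) ⟩
      role (flexEnd + j)                      ≡⟨ role-fixed j ⟩
      fixedRole (j / C) (j % C)               ≡⟨ cong (λ b → if b then fixedAt (j % C) else isolated) (fixedIn-after (j / C) (j % C) late) ⟩
      isolated                                ∎
    where
    open ≡-Reasoning
    F≤i = m+n≤o⇒m≤o flexEnd P≤i
    j = i ∸ flexEnd
    late : J + twice P ≤ j / C
    late = subst (_≤ j / C) (m*n/n≡m (J + twice P) C)
                 (/-monoˡ-≤ C (m+n≤o⇒m≤o∸n ((J + twice P) * C) (subst (_≤ i) (+-comm flexEnd _) P≤i)))

  isFlexible : Role → ℕ
  isFlexible (flexibleAt _) = 1
  isFlexible (fixedAt _)    = 0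
  isFlexible isolated       = 0

  Φ : ℕ
  Φ = ∑[ i < flexEnd ] isFlexible (role i)

  Φ-≡ : Φ ≡ ∑ C nFlex
  Φ-≡ = begin
      Φ                                          ≡⟨ ∑-cong flexEnd (λ i i<F → trans (cong isFlexible (role-flex i i<F)) (flexible? (i / C) (i % C))) ⟩
      ∑[ i < M * C ] 𝟙 (i / C <ᵇ nFlex (i % C))  ≡⟨ ∑-blocks M C (λ r k → 𝟙 (r <ᵇ nFlex k)) ⟩
      ∑[ r < M ] ∑[ k < C ] 𝟙 (r <ᵇ nFlex k)     ≡⟨ ∑-swap M C (λ r k → 𝟙 (r <ᵇ nFlex k)) ⟩
      ∑[ k < C ] ∑[ r < M ] 𝟙 (r <ᵇ nFlex k)     ≡⟨ ∑-cong C (λ k _ → count-below (nFlex k) M (nFlex≤M k)) ⟩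
      ∑ C nFlex                                  ∎
    where
    open ≡-Reasoning
    flexible? : ∀ r k → isFlexible (flexRole r k) ≡ 𝟙 (r <ᵇ nFlex k)
    flexible? r k with r <ᵇ nFlex k
    ... | true  = refl
    ... | false = refl

  Φ-≥ : C * M ≤ Φ + (M * M + M * M)
  Φ-≥ = begin
      C * M                                                     ≡⟨ ∑-const C M ⟨
      ∑[ _ < C ] M                                              ≤⟨ ∑-mono C (λ k _ → nFlex-deficit k) ⟩
      ∑[ k < C ] (nFlex k + ((M ∸ k) + (M ∸ (C ∸ k))))          ≡⟨ ∑-+ C nFlex _ ⟩
      ∑ C nFlex + ∑[ k < C ] ((M ∸ k) + (M ∸ (C ∸ k)))          ≡⟨ cong (∑ C nFlex +_) (∑-+ C (λ k → M ∸ k) (λ k → M ∸ (C ∸ k))) ⟩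
      ∑ C nFlex + (∑[ k < C ] (M ∸ k) + ∑[ k < C ] (M ∸ (C ∸ k)))
                                                                ≤⟨ +-mono-≤ (≤-reflexive (sym Φ-≡)) (+-mono-≤ (∑-∸-≤ M C) (≤-trans (∑-∸-reverse M C) (∑-∸-≤ M C))) ⟩
      Φ + (M * M + M * M)                                       ∎
    where
    open ≤-Reasoning
    -- nFlex k falls short of M only near the two ends of the line.
    nFlex-deficit : ∀ k → M ≤ nFlex k + ((M ∸ k) + (M ∸ (C ∸ k)))
    nFlex-deficit k = ≤-trans (≤⊓+∸ M (k ⊓ (C ∸ k))) (+-monoʳ-≤ (nFlex k) (∸⊓≤ M k (C ∸ k)))

-- The graph on n clients: client i is adjacent to its servers in the two
-- orientations (one server unless it is flexible).
module Instance (C′ M J P : ℕ) (M≤J : M ≤ J) (n : ℕ) where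
  open Line C′ M J P M≤J public

  S : ℕ
  S = C + n

  serverOf<S : ∀ b i → i < n → serverOf b i < S
  serverOf<S b i i<n = bound b (role i) (role-wf i)
    where
    bound : ∀ b R → WellFormed R → serverFor b R i < S
    bound true  (flexibleAt k) (wf-flexible k _ k<C) = <-≤-trans k<C (m≤m+n C n)
    bound false (flexibleAt k) (wf-flexible k _ k<C) = <-≤-trans (≤-<-trans pred[n]≤n k<C) (m≤m+n C n)
    bound b     (fixedAt k)    (wf-fixed k k<C)      = <-≤-trans k<C (m≤m+n C n)
    bound b     isolated       wf-isolated           = +-monoʳ-< C i<n

  two-servers : ∀ i → serverOf false i ≡ serverOf true i
                    ⊎ (suc (serverOf false i) ≡ serverOf true i × serverOf true i < C)
  two-servers i = cases (role i) (role-wf i)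
    where
    cases : ∀ R → WellFormed R → serverFor false R i ≡ serverFor true R i
                                 ⊎ (suc (serverFor false R i) ≡ serverFor true R i × serverFor true R i < C)
    cases (flexibleAt (suc k)) (wf-flexible (suc k) _ k<C) = inj₂ (refl , k<C)
    cases (fixedAt k)          (wf-fixed k _)              = inj₁ refl
    cases isolated             wf-isolated                 = inj₁ refl

  off-line : ∀ b i → C ≤ serverOf b i → serverOf b i ≡ C + i
  off-line b i = cases b (role i) (role-wf i)
    where
    cases : ∀ b R → WellFormed R → C ≤ serverFor b R i → serverFor b R i ≡ C + i
    cases true  (flexibleAt k) (wf-flexible k _ k<C) C≤k = ⊥-elim (<⇒≱ k<C C≤k)
    cases false (flexibleAt k) (wf-flexible k _ k<C) C≤k = ⊥-elim (<⇒≱ (≤-<-trans pred[n]≤n k<C) C≤k)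
    cases b     (fixedAt k)    (wf-fixed k k<C)      C≤k = ⊥-elim (<⇒≱ k<C C≤k)
    cases b     isolated       wf-isolated           _   = refl

  G : Graph n S
  G c s = (toℕ s ≡ᵇ serverOf false (toℕ c)) ∨ (toℕ s ≡ᵇ serverOf true (toℕ c))

  neighbours : ∀ c s → G c s ≡ true → toℕ s ≡ serverOf false (toℕ c) ⊎ toℕ s ≡ serverOf true (toℕ c)
  neighbours c s e with toℕ s ≡ᵇ serverOf false (toℕ c) in e₁
  ... | true  = inj₁ (≡ᵇ⇒≡′ e₁)
  ... | false = inj₂ (≡ᵇ⇒≡′ e)

  lineServer : ∀ k → k < C → Fin S
  lineServer k k<C = fromℕ< (<-≤-trans k<C (m≤m+n C n))

  toℕ-lineServer : ∀ k k<C → toℕ (lineServer k k<C) ≡ k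
  toℕ-lineServer k k<C = toℕ-fromℕ< _

  oriented : Bool → Assignment n S
  oriented b c = fromℕ< (serverOf<S b (toℕ c) (toℕ<n c))

  toℕ-oriented : ∀ b c → toℕ (oriented b c) ≡ serverOf b (toℕ c)
  toℕ-oriented b c = toℕ-fromℕ< _

  oriented-valid : ∀ b t → ValidAt G t (oriented b)
  oriented-valid true  t c _ rewrite toℕ-oriented true c  | ≡ᵇ-refl (serverOf true (toℕ c)) = ∨-zeroʳ _
  oriented-valid false t c _ rewrite toℕ-oriented false c | ≡ᵇ-refl (serverOf false (toℕ c)) = refl

  Balanced : Bool → ℕ → ℕ → Set
  Balanced b T j = ∀ k → k < C → ∑[ i < T ] 𝟙 (serverOf b i ≡ᵇ k) ≡ j

  balanced-phaseEnd : ∀ p → p ≤ P → Balanced (flips p true) (phaseEnd p) (J + p)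
  balanced-phaseEnd p p≤P k k<C = load-phaseEnd p k p≤P k<C

  -- Isolated latecomers do not change line loads.
  balanced-final : flips P true ≡ true → phaseEnd P ≤ n → Balanced true n (J + P)
  balanced-final even P≤n k k<C = begin
      ∑[ i < n ] 𝟙 (serverOf true i ≡ᵇ k)                          ≡⟨ cong (λ x → ∑[ i < x ] 𝟙 (serverOf true i ≡ᵇ k)) (sym (m+[n∸m]≡n P≤n)) ⟩
      ∑[ i < phaseEnd P + (n ∸ phaseEnd P) ] 𝟙 (serverOf true i ≡ᵇ k) ≡⟨ ∑-split (phaseEnd P) (n ∸ phaseEnd P) _ ⟩
      ∑[ i < phaseEnd P ] 𝟙 (serverOf true i ≡ᵇ k)
        + ∑[ u < n ∸ phaseEnd P ] 𝟙 (serverOf true (phaseEnd P + u) ≡ᵇ k)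
                                                                   ≡⟨ cong₂ _+_ final-phase (∑-zero (n ∸ phaseEnd P) latecomer) ⟩
      J + P + 0                                                    ≡⟨ +-identityʳ (J + P) ⟩
      J + P                                                        ∎
    where
    open ≡-Reasoning
    final-phase : ∑[ i < phaseEnd P ] 𝟙 (serverOf true i ≡ᵇ k) ≡ J + P
    final-phase = subst (λ b → ∑[ i < phaseEnd P ] 𝟙 (serverOf b i ≡ᵇ k) ≡ J + P) even (load-phaseEnd P k ≤-refl k<C)
    latecomer : ∀ u → u < n ∸ phaseEnd P → 𝟙 (serverOf true (phaseEnd P + u) ≡ᵇ k) ≡ 0
    latecomer u _ = trans (cong (λ R → 𝟙 (serverFor true R (phaseEnd P + u) ≡ᵇ k)) (role-after (phaseEnd P + u) (m≤m+n (phaseEnd P) u)))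
                          (isolated-off-line k (phaseEnd P + u) k<C)

  load-off-line : ∀ b T x → C ≤ x → ∑[ i < T ] 𝟙 (serverOf b i ≡ᵇ x) ≤ 1
  load-off-line b T x C≤x = ≤-trans (∑-mono T owner) (count-point-≤1 (x ∸ C) T)
    where
    owner : ∀ i → i < T → 𝟙 (serverOf b i ≡ᵇ x) ≤ 𝟙 (i ≡ᵇ x ∸ C)
    owner i _ with serverOf b i ≡ᵇ x in e
    ... | false = z≤n
    ... | true  = ≤-reflexive (sym (cong 𝟙 (subst (λ z → (i ≡ᵇ z) ≡ true) i≡x∸C (≡ᵇ-refl i))))
      where
      on-x : serverOf b i ≡ x
      on-x = ≡ᵇ⇒≡′ e
      i≡x∸C : i ≡ x ∸ C
      i≡x∸C = trans (sym (m+n∸m≡n C i))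
                    (cong (_∸ C) (trans (sym (off-line b i (subst (C ≤_) (sym on-x) C≤x))) on-x))

  oriented-maxLoad : ∀ b T j → T ≤ n → 1 ≤ j → Balanced b T j → maxLoadAt T (oriented b) ≤ j
  oriented-maxLoad b T j T≤n 1≤j bal = maxLoad≤ T (oriented b) j load≤j
    where
    load≤j : ∀ s → loadAt T (oriented b) s ≤ j
    load≤j s with toℕ s <? C | load-follows (oriented b) T (serverOf b) s T≤n (toℕ-oriented b)
    ... | yes s<C | eq = ≤-reflexive (trans eq (bal (toℕ s) s<C))
    ... | no  s≮C | eq = ≤-trans (≤-reflexive eq) (≤-trans (load-off-line b T (toℕ s) (≮⇒≥ s≮C)) 1≤j)

  -- Clients whose right server is 0 have no other neighbour, so every
  -- assignment puts at least j clients on server 0 when line loads are j.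
  server0-full : ∀ T j (B : Assignment n S) → T ≤ n → ValidAt G T B → Balanced true T j →
    j ≤ loadAt T B (lineServer 0 z<s)
  server0-full T j B T≤n valid bal =
    ≤-trans (≤-reflexive (sym (bal 0 z<s))) (load-≥ B T (λ i → 𝟙 (serverOf true i ≡ᵇ 0)) s₀ T≤n on-0)
    where
    s₀ = lineServer 0 z<s
    on-0 : ∀ c → toℕ c < T → 𝟙 (serverOf true (toℕ c) ≡ᵇ 0) ≤ 𝟙 (does (B c ≟ᶠ s₀))
    on-0 c c<T with serverOf true (toℕ c) ≡ᵇ 0 in e
    ... | false = z≤n
    ... | true with two-servers (toℕ c) | neighbours c (B c) (valid c c<T)
    ...   | inj₂ (consecutive , _) | _      = ⊥-elim (1+n≢0 (trans consecutive (≡ᵇ⇒≡′ e)))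
    ...   | inj₁ same | inj₁ on-left  = 𝟙-assigned B c s₀ (trans on-left (trans same (trans (≡ᵇ⇒≡′ e) (sym (toℕ-lineServer 0 z<s)))))
    ...   | inj₁ same | inj₂ on-right = 𝟙-assigned B c s₀ (trans on-right (trans (≡ᵇ⇒≡′ e) (sym (toℕ-lineServer 0 z<s))))

  opt-final : flips P true ≡ true → 1 ≤ J → phaseEnd P ≤ n → OptIs G (J + P)
  opt-final even 1≤J P≤n =
    oriented true , (oriented-valid true n , optimal) , ≤-antisym upper (≤-trans (server0-full n (J + P) (oriented true) ≤-refl (oriented-valid true n) bal) (load≤maxLoad n (oriented true) _))
    where
    bal = balanced-final even P≤n
    upper : maxLoadAt n (oriented true) ≤ J + P
    upper = oriented-maxLoad true n (J + P) ≤-refl (≤-trans 1≤J (m≤m+n J P)) bal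
    optimal : ∀ B → ValidAt G n B → maxLoadAt n (oriented true) ≤ maxLoadAt n B
    optimal B valid = ≤-trans upper (≤-trans (server0-full n (J + P) B ≤-refl valid bal) (load≤maxLoad n B _))

  no-room : ∀ T j (B : Assignment n S) (f : ℕ → ℕ) k → k < C → T ≤ n → (∀ s → loadAt T B s ≤ j) →
    ∑[ i < T ] 𝟙 (f i ≡ᵇ k) ≡ j → (∀ c → toℕ c < T → f (toℕ c) ≡ k → toℕ (B c) ≡ k) →
    ∀ c₀ → toℕ c₀ < T → f (toℕ c₀) ≢ k → toℕ (B c₀) ≢ k
  no-room T j B f k k<C T≤n loads≤j count on-k c₀ c₀<T f≢k on-k₀ = <-irrefl refl (≤-trans overfull (loads≤j s))
    where
    s = lineServer k k<C
    g : ℕ → ℕ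
    g i = 𝟙 (f i ≡ᵇ k) + 𝟙 (i ≡ᵇ toℕ c₀)
    on-s : ∀ c → toℕ c < T → g (toℕ c) ≤ 𝟙 (does (B c ≟ᶠ s))
    on-s c c<T with f (toℕ c) ≡ᵇ k in e₁ | toℕ c ≡ᵇ toℕ c₀ in e₂
    ... | true  | true  = ⊥-elim (f≢k (subst (λ z → f (toℕ z) ≡ k) (toℕ-injective (≡ᵇ⇒≡′ e₂)) (≡ᵇ⇒≡′ e₁)))
    ... | true  | false = 𝟙-assigned B c s (trans (on-k c c<T (≡ᵇ⇒≡′ e₁)) (sym (toℕ-lineServer k k<C)))
    ... | false | true  = 𝟙-assigned B c s (trans (cong (toℕ ∘ B) (toℕ-injective (≡ᵇ⇒≡′ e₂))) (trans on-k₀ (sym (toℕ-lineServer k k<C))))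
    ... | false | false = z≤n
    overfull : suc j ≤ loadAt T B s
    overfull = ≤-trans (≤-reflexive (begin
        suc j                                              ≡⟨ +-comm 1 j ⟩
        j + 1                                              ≡⟨ cong₂ _+_ count (count-point (toℕ c₀) T c₀<T) ⟨
        ∑[ i < T ] 𝟙 (f i ≡ᵇ k) + ∑[ i < T ] 𝟙 (i ≡ᵇ toℕ c₀) ≡⟨ ∑-+ T (λ i → 𝟙 (f i ≡ᵇ k)) (λ i → 𝟙 (i ≡ᵇ toℕ c₀)) ⟨
        ∑ T g                                              ∎))
      (load-≥ B T g s T≤n on-s)
      where open ≡-Reasoning

  module Forced (T j : ℕ) (B : Assignment n S) (T≤n : T ≤ n) (valid : ValidAt G T B)
                (loads≤j : ∀ s → loadAt T B s ≤ j) where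

    on-neighbour : ∀ c → toℕ c < T → toℕ (B c) ≡ serverOf false (toℕ c) ⊎ toℕ (B c) ≡ serverOf true (toℕ c)
    on-neighbour c c<T = neighbours c (B c) (valid c c<T)

    -- Orientation right, by induction along the line from server 0: a client
    -- of k pointing left would join the full server k − 1.
    forced-right : Balanced true T j → ∀ k → k < C → ∀ c → toℕ c < T →
      serverOf true (toℕ c) ≡ k → toℕ (B c) ≡ k
    forced-right bal k k<C c c<T right≡k with two-servers (toℕ c) | on-neighbour c c<T
    ... | inj₁ same | inj₁ on-left  = trans on-left (trans same right≡k)
    ... | inj₁ _    | inj₂ on-right = trans on-right right≡k
    ... | inj₂ _    | inj₂ on-right = trans on-right right≡k
    forced-right bal zero    k<C c c<T right≡0 | inj₂ (consecutive , _) | inj₁ on-left =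
      ⊥-elim (1+n≢0 (trans consecutive right≡0))
    forced-right bal (suc k) k<C c c<T right≡1+k | inj₂ (consecutive , _) | inj₁ on-left =
      ⊥-elim (no-room T j B (serverOf true) k k<C′ T≤n loads≤j (bal k k<C′) (forced-right bal k k<C′)
                c c<T (λ right≡k → 1+n≢n (trans (sym right≡1+k) right≡k)) (trans on-left (suc-injective (trans consecutive right≡1+k))))
      where
      k<C′ = <-trans (n<1+n k) k<C

    -- Orientation left, by induction from server C − 1 down, d = C − 1 − k.
    forced-left : Balanced false T j → ∀ d k → k + d ≡ C′ → ∀ c → toℕ c < T →
      serverOf false (toℕ c) ≡ k → toℕ (B c) ≡ k
    forced-left bal d k k+d≡C′ c c<T left≡k with two-servers (toℕ c) | on-neighbour c c<T
    ... | inj₁ _    | inj₁ on-left  = trans on-left left≡k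
    ... | inj₁ same | inj₂ on-right = trans on-right (trans (sym same) left≡k)
    ... | inj₂ _    | inj₁ on-left  = trans on-left left≡k
    forced-left bal zero    k k≡C′ c c<T left≡k | inj₂ (consecutive , right<C) | inj₂ on-right =
      ⊥-elim (<-irrefl refl (subst (_< C) (trans (sym consecutive) (cong suc (trans left≡k (trans (sym (+-identityʳ k)) k≡C′)))) right<C))
    forced-left bal (suc d) k k+d≡C′ c c<T left≡k | inj₂ (consecutive , right<C) | inj₂ on-right =
      ⊥-elim (no-room T j B (serverOf false) (suc k) 1+k<C T≤n loads≤j (bal (suc k) 1+k<C)
                (forced-left bal d (suc k) (trans (sym (+-suc k d)) k+d≡C′))
                c c<T (λ left≡1+k → 1+n≢n (trans (sym left≡1+k) left≡k)) (trans on-right right≡1+k))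
      where
      right≡1+k : serverOf true (toℕ c) ≡ suc k
      right≡1+k = trans (sym consecutive) (cong suc left≡k)
      1+k<C : suc k < C
      1+k<C = subst (_< C) right≡1+k right<C

    forced : ∀ b → Balanced b T j → ∀ c → toℕ c < T → serverOf b (toℕ c) < C → toℕ (B c) ≡ serverOf b (toℕ c)
    forced true  bal c c<T on-line = forced-right bal _ on-line c c<T refl
    forced false bal c c<T on-line =
      forced-left bal (C′ ∸ serverOf false (toℕ c)) _ (m+[n∸m]≡n (s≤s⁻¹ on-line)) c c<T refl

  flexible-servers : ∀ b i → 1 ≤ isFlexible (role i) →
    serverOf b i < C × serverOf (not b) i < C × serverOf b i ≢ serverOf (not b) i
  flexible-servers b i = cases b (role i) (role-wf i)
    where
    cases : ∀ b R → WellFormed R → 1 ≤ isFlexible R →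
      serverFor b R i < C × serverFor (not b) R i < C × serverFor b R i ≢ serverFor (not b) R i
    cases true  (flexibleAt (suc k)) (wf-flexible _ _ k<C) _ = k<C , <-trans (n<1+n k) k<C , 1+n≢n
    cases false (flexibleAt (suc k)) (wf-flexible _ _ k<C) _ = <-trans (n<1+n k) k<C , k<C , 1+n≢n ∘ sym

  isFlexible≤1 : ∀ R → isFlexible R ≤ 1
  isFlexible≤1 (flexibleAt _) = ≤-refl
  isFlexible≤1 (fixedAt _)    = z≤n
  isFlexible≤1 isolated       = z≤n

  phaseEnd-mono : ∀ {p q} → p ≤ q → phaseEnd p ≤ phaseEnd q
  phaseEnd-mono p≤q = +-monoʳ-≤ flexEnd (*-monoˡ-≤ C (+-monoʳ-≤ J (twice-mono p≤q)))

  flexEnd≤phaseEnd : ∀ p → flexEnd ≤ phaseEnd p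
  flexEnd≤phaseEnd p = m≤m+n flexEnd _

  phaseEnd-suc : ∀ p → phaseEnd (suc p) ≡ phaseEnd p + (C + C)
  phaseEnd-suc p = begin
      flexEnd + (J + suc (suc (twice p))) * C   ≡⟨ cong (λ x → flexEnd + x * C) (trans (+-suc J (suc (twice p))) (cong suc (+-suc J (twice p)))) ⟩
      flexEnd + (C + (C + (J + twice p) * C))   ≡⟨ cong (flexEnd +_) (trans (sym (+-assoc C C _)) (+-comm (C + C) _)) ⟩
      flexEnd + ((J + twice p) * C + (C + C))   ≡⟨ sym (+-assoc flexEnd _ (C + C)) ⟩
      phaseEnd p + (C + C)                      ∎
    where open ≡-Reasoning

module LowerBound (C′ M J P : ℕ) (M≤J : M ≤ J) (n : ℕ) (1≤J : 1 ≤ J)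
                  (P≤n : Instance.phaseEnd C′ M J P M≤J n P ≤ n)
                  (A : Run n (Instance.S C′ M J P M≤J n)) (exact : Exact (Instance.G C′ M J P M≤J n) A) where
  open Instance C′ M J P M≤J n

  phaseEnd≤n : ∀ p → p ≤ P → phaseEnd p ≤ n
  phaseEnd≤n p p≤P = ≤-trans (phaseEnd-mono p≤P) P≤n

  -- At the end of phase p the algorithm is optimal, hence uses orientation
  -- flips p true on every line client.
  oriented-at : ∀ p → p ≤ P → ∀ c → toℕ c < phaseEnd p → serverOf (flips p true) (toℕ c) < C →
    toℕ (A (phaseEnd p) c) ≡ serverOf (flips p true) (toℕ c)
  oriented-at p p≤P = Forced.forced (phaseEnd p) (J + p) (A (phaseEnd p)) T≤n (proj₁ optimal) loads≤ b bal
    where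
    b = flips p true
    T≤n = phaseEnd≤n p p≤P
    bal = balanced-phaseEnd p p≤P
    optimal = exact (phaseEnd p) T≤n
    loads≤ : ∀ s → loadAt (phaseEnd p) (A (phaseEnd p)) s ≤ J + p
    loads≤ s = ≤-trans (load≤maxLoad (phaseEnd p) (A (phaseEnd p)) s)
                (≤-trans (proj₂ optimal (oriented b) (oriented-valid b (phaseEnd p)))
                         (oriented-maxLoad b (phaseEnd p) (J + p) T≤n (≤-trans 1≤J (m≤m+n J p)) bal))

  flexible-moves : ∀ p → p < P → ∀ c → toℕ c < flexEnd → 1 ≤ isFlexible (role (toℕ c)) →
    A (phaseEnd p) c ≢ A (phaseEnd (suc p)) c
  flexible-moves p p<P c early flexible same = differ (trans (sym before) (trans (cong toℕ same) after))
    where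
    b = flips p true
    servers = flexible-servers b (toℕ c) flexible
    differ = proj₂ (proj₂ servers)
    before : toℕ (A (phaseEnd p) c) ≡ serverOf b (toℕ c)
    before = oriented-at p (<⇒≤ p<P) c (<-≤-trans early (flexEnd≤phaseEnd p)) (proj₁ servers)
    after : toℕ (A (phaseEnd (suc p)) c) ≡ serverOf (not b) (toℕ c)
    after = subst (λ b′ → serverOf b′ (toℕ c) < C → toℕ (A (phaseEnd (suc p)) c) ≡ serverOf b′ (toℕ c))
                  (flips-not p true)
                  (oriented-at (suc p) p<P c (<-≤-trans early (flexEnd≤phaseEnd (suc p))))
                  (proj₁ (proj₂ servers))

  phase-moves : ∀ p → p < P → Φ ≤ moved A (phaseEnd p) (phaseEnd (suc p))
  phase-moves p p<P = begin
      Φ                                                              ≡⟨ ∑-prefix flexEnd n _ (≤-trans (flexEnd≤phaseEnd 0) (phaseEnd≤n 0 z≤n)) ⟨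
      ∑[ i < n ] 𝟙 (i <ᵇ flexEnd) * isFlexible (role i)              ≡⟨ sum-allFin n (λ i → 𝟙 (i <ᵇ flexEnd) * isFlexible (role i)) ⟨
      sum (map (λ c → 𝟙 (toℕ c <ᵇ flexEnd) * isFlexible (role (toℕ c))) (allFin n))
                                                                     ≤⟨ sum-map-mono _ _ (allFin n) counted ⟩
      moved A (phaseEnd p) (phaseEnd (suc p))                        ∎
    where
    open ≤-Reasoning
    changed : ∀ c → A (phaseEnd p) c ≢ A (phaseEnd (suc p)) c → not (does (A (phaseEnd p) c ≟ᶠ A (phaseEnd (suc p)) c)) ≡ true
    changed c differ with A (phaseEnd p) c ≟ᶠ A (phaseEnd (suc p)) c
    ... | yes same = ⊥-elim (differ same)
    ... | no  _    = refl
    counted : ∀ c → 𝟙 (toℕ c <ᵇ flexEnd) * isFlexible (role (toℕ c))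
                  ≤ 𝟙 ((toℕ c <ᵇ phaseEnd p) ∧ not (does (A (phaseEnd p) c ≟ᶠ A (phaseEnd (suc p)) c)))
    counted c = by-arrival (toℕ c <ᵇ flexEnd) refl
      where
      by-arrival : ∀ early → (toℕ c <ᵇ flexEnd) ≡ early → 𝟙 early * isFlexible (role (toℕ c))
                   ≤ 𝟙 ((toℕ c <ᵇ phaseEnd p) ∧ not (does (A (phaseEnd p) c ≟ᶠ A (phaseEnd (suc p)) c)))
      by-arrival false _ = z≤n
      by-arrival true  e rewrite <⇒<ᵇ′ (<-≤-trans (<ᵇ⇒<′ e) (flexEnd≤phaseEnd p)) =
        ≤-trans (≤-reflexive (+-identityʳ _))
                (≤𝟙 _ _ (isFlexible≤1 (role (toℕ c))) (λ flexible → changed c (flexible-moves p p<P c (<ᵇ⇒<′ e) flexible)))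

  changes-until : ∀ p → p ≤ P → p * Φ ≤ ∑ (phaseEnd p) (changesAt A)
  changes-until zero    _     = z≤n
  changes-until (suc p) 1+p≤P = begin
      Φ + p * Φ                                                  ≤⟨ +-mono-≤ (phase-moves p 1+p≤P) (changes-until p (<⇒≤ 1+p≤P)) ⟩
      moved A (phaseEnd p) (phaseEnd (suc p)) + ∑ t ch           ≡⟨ cong (λ x → moved A t x + ∑ t ch) (phaseEnd-suc p) ⟩
      moved A t (t + (C + C)) + ∑ t ch                           ≤⟨ +-monoˡ-≤ _ (moved≤changes A t (C + C)) ⟩
      ∑[ u < C + C ] ch (t + u) + ∑ t ch                         ≡⟨ +-comm _ (∑ t ch) ⟩
      ∑ t ch + ∑[ u < C + C ] ch (t + u)                         ≡⟨ ∑-split t (C + C) ch ⟨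
      ∑ (t + (C + C)) ch                                         ≡⟨ cong (λ x → ∑ x ch) (phaseEnd-suc p) ⟨
      ∑ (phaseEnd (suc p)) ch                                    ∎
    where
    open ≤-Reasoning
    t = phaseEnd p
    ch = changesAt A

  total : P * Φ ≤ totalChanges A
  total = begin
      P * Φ                                                    ≤⟨ changes-until P ≤-refl ⟩
      ∑ (phaseEnd P) ch                                        ≤⟨ m≤m+n _ _ ⟩
      ∑ (phaseEnd P) ch + ∑[ u < n ∸ phaseEnd P ] ch (phaseEnd P + u) ≡⟨ ∑-split (phaseEnd P) (n ∸ phaseEnd P) ch ⟨
      ∑ (phaseEnd P + (n ∸ phaseEnd P)) ch                     ≡⟨ cong (λ x → ∑ x ch) (m+[n∸m]≡n P≤n) ⟩
      ∑ n ch                                                   ≡⟨ totalChanges-∑ A ⟨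
      totalChanges A                                           ∎
    where
    open ≤-Reasoning
    ch = changesAt A

-- The arithmetic of the final estimate.  With M = a, P = 2a and C ≥ 4a,
-- P·Φ ≥ 2a·(C·a − 2a²) ≥ a²·C, while n < 7a·(C + 1) ≤ 14a·C.
flexible-bound : ∀ a C Φ → a * 4 ≤ C → C * a ≤ Φ + (a * a + a * a) → a * a * C ≤ (a + a) * Φ
flexible-bound a C Φ 4a≤C Φ-≥ = +-cancelʳ-≤ X X ((a + a) * Φ) (begin
    X + X                                         ≡⟨ lemma₁ a C ⟩
    (a + a) * (C * a)                             ≤⟨ *-monoʳ-≤ (a + a) Φ-≥ ⟩
    (a + a) * (Φ + (a * a + a * a))               ≡⟨ *-distribˡ-+ (a + a) Φ _ ⟩
    (a + a) * Φ + (a + a) * (a * a + a * a)       ≡⟨ cong ((a + a) * Φ +_) (lemma₂ a) ⟩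
    (a + a) * Φ + (a * 4) * (a * a)               ≤⟨ +-monoʳ-≤ ((a + a) * Φ) (*-monoˡ-≤ (a * a) 4a≤C) ⟩
    (a + a) * Φ + C * (a * a)                     ≡⟨ cong ((a + a) * Φ +_) (*-comm C (a * a)) ⟩
    (a + a) * Φ + X                               ∎)
  where
  open ≤-Reasoning
  X = a * a * C
  lemma₁ : ∀ a C → a * a * C + a * a * C ≡ (a + a) * (C * a)
  lemma₁ = solve-∀
  lemma₂ : ∀ a → (a + a) * (a * a + a * a) ≡ (a * 4) * (a * a)
  lemma₂ = solve-∀

final-estimate : ∀ a C Φ n changes → 1 ≤ C → a * 4 ≤ C → C * a ≤ Φ + (a * a + a * a) →
  n < a * 7 + C * (a * 7) → (a + a) * Φ ≤ changes → n * (a * 4) ≤ 56 * changes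
final-estimate a C Φ n changes 1≤C 4a≤C Φ-≥ n< enough = begin
    n * (a * 4)                              ≤⟨ *-monoˡ-≤ (a * 4) (<⇒≤ n<) ⟩
    (a * 7 + C * (a * 7)) * (a * 4)          ≡⟨ expand a C ⟩
    28 * (a * a) + 28 * (a * a * C)          ≤⟨ +-monoˡ-≤ _ (*-monoʳ-≤ 28 (≤-trans (≤-reflexive (sym (*-identityʳ (a * a)))) (*-monoʳ-≤ (a * a) 1≤C))) ⟩
    28 * (a * a * C) + 28 * (a * a * C)      ≡⟨ double (a * a * C) ⟩
    56 * (a * a * C)                         ≤⟨ *-monoʳ-≤ 56 (flexible-bound a C Φ 4a≤C Φ-≥) ⟩
    56 * ((a + a) * Φ)                       ≤⟨ *-monoʳ-≤ 56 enough ⟩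
    56 * changes                             ∎
  where
  open ≤-Reasoning
  expand : ∀ a C → (a * 7 + C * (a * 7)) * (a * 4) ≡ 28 * (a * a) + 28 * (a * a * C)
  expand = solve-∀
  double : ∀ x → 28 * x + 28 * x ≡ 56 * x
  double = solve-∀

-- The instance for L = 4a: M = a, J = P = 2a, and C = ⌊n / 7a⌋ ≥ 4a line
-- servers, so that the 7a·C clients of the construction fit into n.
instance-for : ∀ n a′ → 2 * ((suc a′ * 4) * (suc a′ * 4)) ≤ n →
  Σ ℕ λ m → Σ (Graph n m) λ G →
    OptIs G (suc a′ * 4) × (∀ (A : Run n m) → Exact G A → n * (suc a′ * 4) ≤ 56 * totalChanges A)
instance-for n a′ 2L²≤n = S , G , subst (OptIs G) L≡ (opt-final (flips-twice a true) 1≤J fits) , lower-bound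
  where
  a = suc a′
  rounds : a + (twice a + twice (twice a)) ≡ a * 7
  rounds = trans (cong (a +_) (cong₂ _+_ (twice-≡ a) (trans (twice-≡ (twice a)) (cong₂ _+_ (twice-≡ a) (twice-≡ a)))))
                 (identity a)
    where
    identity : ∀ a → a + ((a + a) + ((a + a) + (a + a))) ≡ a * 7
    identity = solve-∀
  width : ℕ
  width = n / (a * 7)
  width-fits : width * (a * 7) ≤ n
  width-fits = m/n*n≤m n (a * 7)
  n< : n < a * 7 + width * (a * 7)
  n< = subst (_< a * 7 + width * (a * 7)) (sym (m≡m%n+[m/n]*n n (a * 7))) (+-monoˡ-< (width * (a * 7)) (m%n<n n (a * 7)))
  4a≤width : a * 4 ≤ width
  4a≤width = subst (_≤ width) (m*n/n≡m (a * 4) (a * 7)) (/-monoˡ-≤ (a * 7) (≤-trans 28a²≤32a² 2L²≤n))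
    where
    identity : ∀ a → 2 * ((a * 4) * (a * 4)) ≡ (a * 4) * (a * 7) + 4 * (a * a)
    identity = solve-∀
    28a²≤32a² : (a * 4) * (a * 7) ≤ 2 * ((a * 4) * (a * 4))
    28a²≤32a² = ≤-trans (m≤m+n _ (4 * (a * a))) (≤-reflexive (sym (identity a)))
  C′ = pred width
  C≡ : suc C′ ≡ width
  C≡ = suc-pred width {{>-nonZero (≤-trans (s≤s z≤n) 4a≤width)}}
  a≤2a : a ≤ twice a
  a≤2a = subst (a ≤_) (sym (twice-≡ a)) (m≤m+n a a)
  open Instance C′ a (twice a) (twice a) a≤2a n
  1≤J : 1 ≤ twice a
  1≤J = s≤s z≤n
  fits : phaseEnd (twice a) ≤ n
  fits = ≤-trans (≤-reflexive (begin
      a * C + (twice a + twice (twice a)) * C  ≡⟨ *-distribʳ-+ C a _ ⟨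
      (a + (twice a + twice (twice a))) * C    ≡⟨ cong₂ _*_ rounds C≡ ⟩
      a * 7 * width                            ≡⟨ *-comm (a * 7) width ⟩
      width * (a * 7)                          ∎)) width-fits
    where open ≡-Reasoning
  L≡ : twice a + twice a ≡ a * 4
  L≡ = trans (cong₂ _+_ (twice-≡ a) (twice-≡ a)) (identity a)
    where
    identity : ∀ a → (a + a) + (a + a) ≡ a * 4
    identity = solve-∀
  lower-bound : ∀ (A : Run n S) → Exact G A → n * (a * 4) ≤ 56 * totalChanges A
  lower-bound A exact =
    final-estimate a (suc C′) Φ n (totalChanges A) (s≤s z≤n) (subst (a * 4 ≤_) (sym C≡) 4a≤width) Φ-≥
                   (subst (λ x → n < a * 7 + x * (a * 7)) (sym C≡) n<)
                   (subst (λ x → x * Φ ≤ totalChanges A) (twice-≡ a) (LowerBound.total C′ a (twice a) (twice a) a≤2a n 1≤J fits A exact))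

theorem4 : ∃ λ (d : ℕ) → ∀ (n L : ℕ) → 1 ≤ n → 1 ≤ L → 4 ∣ L → 2 * (L * L) ≤ n →
    Σ ℕ λ m → Σ (Graph n m) λ G →
    OptIs G L × (∀ (A : Run n m) → Exact G A → n * L ≤ d * totalChanges A)
theorem4 = 56 , construction
  where
  construction : ∀ (n L : ℕ) → 1 ≤ n → 1 ≤ L → 4 ∣ L → 2 * (L * L) ≤ n →
    Σ ℕ λ m → Σ (Graph n m) λ G → OptIs G L × (∀ (A : Run n m) → Exact G A → n * L ≤ 56 * totalChanges A)
  construction n .(suc a′ * 4) _ _ (divides (suc a′) refl) 2L²≤n = instance-for n a′ 2L²≤n
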